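{- Consider a pairing performed during an Extract-Min on a pairing heap, between a node $a$ and its immediate right sibling $b$, and let $c$ be the immediate right sibling of $b$ before the pairing (if $b$ has no right sibling, $c$ is taken to be an imagined lone black node, so $s(c)=0$, with the convention $\log_2 0=-\infty$). Let $w$ be the winner and $l$ the loser of the pairing (so $w$ takes the position of $a$ and $l$ becomes the leftmost child of $w$). If both $a$ and $b$ are white, then the change in rank potential caused by the pairing satisfies $$r(w)+r(l)-r(a)-r(b)\le 36\log_2 s(a)-36\log_2 s(c)-36,$$ where $r(a),r(b)$ and $s(a),s(c)$ are evaluated before the pairing and $r(w),r(l)$ after it.
   Context: A pairing heap is a heap-ordered (min-heap) rooted ordered tree; pairing two trees makes the root with the larger key the leftmost child of the other root. During Extract-Min the root is removed, its children are paired left to right in pairs (first with second, third with fourth, ...), and then the two rightmost remaining trees are repeatedly paired until one remains; each such pairing is between a node and its immediate right sibling among the current list of trees. Binary representation: each node's left child is its leftmost child and its right child is its immediate right sibling. Fix a sequence of operations; a node is black if it remains in the collection of heaps at the end of the sequence and white otherwise. For a node $x$, $s(x)$ is the number of white nodes in the subtree of $x$ in the binary representation (including $x$). The rank potential of a white node $x$ is $r(x)=18\log_2 s(x)$; black nodes have rank potential $0$. -}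

module Defs where

open import Data.Nat using (ℕ; zero; suc; _+_; _*_; _^_; _≤_; _≤?_)
open import Data.Bool using (Bool; true; false; if_then_else_)
open import Relation.Nullary using (yes; no)

-- Binary representation of a pairing heap (forest of heap-ordered trees):
-- left = leftmost child, right = immediate right sibling.
data Tree : Set where
  leaf : Tree
  node : (key : ℕ) (white : Bool) (left right : Tree) → Tree

leftChild : Tree → Tree
leftChild leaf           = leaf
leftChild (node _ _ l _) = l

rightChild : Tree → Tree
rightChild leaf           = leaf
rightChild (node _ _ _ r) = r

s : Tree → ℕ
s leaf           = 0
s (node _ c l r) = (if c then 1 else 0) + s l + s r

-- Ties are won by a (immaterial for the lemma).
pair : Tree → Tree
pair (node ka ca A (node kb cb B C)) with ka ≤? kb
... | yes _ = node ka ca (node kb cb B A) C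
... | no  _ = node kb cb (node ka ca A B) C
pair t = t

{-# OPTIONS --safe #-}
-- Both roots are white, so the winner w has s(w) = 1 + s(l) + s(c), and pairing
-- does not change the number of white nodes below a's position: s(w) = s(a).
-- Exponentiating, the claim becomes 4 s(w) s(l) s(c)² ≤ s(a)³ s(b), which follows
-- from AM-GM, 4 s(l) s(c) ≤ (s(l) + s(c))² ≤ s(a)², together with s(c) ≤ s(b).
module Submission where

open import Defs
open import Data.Nat using (ℕ; suc; _+_; _*_; _^_; _≤_; _≤?_)
open import Data.Nat.Properties
  using (≤-total; m≤m+n; m≤n+m; n≤1+n; ≤-trans; ^-monoˡ-≤; +-comm; *-mono-≤; *-monoʳ-≤; m≤n⇒∃[o]m+o≡n)
open import Data.Nat.Solver using (module +-*-Solver)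
open import Data.Bool using (Bool; true; if_then_else_)
open import Data.Product using (_,_)
open import Data.Sum using (inj₁; inj₂)
open import Relation.Binary.PropositionalEquality using (_≡_; refl; sym; trans; cong; subst; subst₂)
open import Relation.Nullary using (yes; no)
open +-*-Solver

m≤n⇒4*m*n≤[m+n]^2 : ∀ {m n} → m ≤ n → 4 * m * n ≤ (m + n) ^ 2
m≤n⇒4*m*n≤[m+n]^2 {m} m≤n with m≤n⇒∃[o]m+o≡n m≤n
... | d , refl = subst (4 * m * (m + d) ≤_)
  (solve 2 (λ m d → con 4 :* m :* (m :+ d) :+ d :* d := (m :+ (m :+ d)) :^ 2) refl m d)
  (m≤m+n (4 * m * (m + d)) (d * d))

4*m*n≤[m+n]^2 : ∀ m n → 4 * m * n ≤ (m + n) ^ 2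
4*m*n≤[m+n]^2 m n with ≤-total m n
... | inj₁ m≤n = m≤n⇒4*m*n≤[m+n]^2 m≤n
... | inj₂ n≤m = subst₂ _≤_
  (solve 2 (λ m n → con 4 :* n :* m := con 4 :* m :* n) refl m n)
  (cong (_^ 2) (+-comm n m))
  (m≤n⇒4*m*n≤[m+n]^2 n≤m)

4*S*p*z²≤S³*q : ∀ {S p z q} → p + z ≤ S → z ≤ q → 4 * S * p * z ^ 2 ≤ S ^ 3 * q
4*S*p*z²≤S³*q {S} {p} {z} {q} p+z≤S z≤q = subst₂ _≤_
  (solve 3 (λ S p z → S :* (con 4 :* p :* z :* z) := con 4 :* S :* p :* z :^ 2) refl S p z)
  (solve 2 (λ S q → S :* (S :^ 2 :* q) := S :^ 3 :* q) refl S q)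
  (*-monoʳ-≤ S (*-mono-≤ 4pz≤S² z≤q))
  where
  4pz≤S² : 4 * p * z ≤ S ^ 2
  4pz≤S² = ≤-trans (4*m*n≤[m+n]^2 p z) (^-monoˡ-≤ 2 p+z≤S)

colourWeight : Bool → ℕ
colourWeight c = if c then 1 else 0

s-pair : ∀ t → s (pair t) ≡ s t
s-pair leaf = refl
s-pair (node _ _ _ leaf) = refl
s-pair (node ka ca A (node kb cb B C)) with ka ≤? kb
... | yes _ = solve 5 (λ a b A B C → a :+ (b :+ B :+ A) :+ C := a :+ A :+ (b :+ B :+ C)) refl
                (colourWeight ca) (colourWeight cb) (s A) (s B) (s C)
... | no  _ = solve 5 (λ a b A B C → b :+ (a :+ A :+ B) :+ C := a :+ A :+ (b :+ B :+ C)) refl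
                (colourWeight ca) (colourWeight cb) (s A) (s B) (s C)

s-pair-white : ∀ ka kb A B C → let w = pair (node ka true A (node kb true B C))
                               in s w ≡ suc (s (leftChild w) + s C)
s-pair-white ka kb A B C with ka ≤? kb
... | yes _ = refl
... | no  _ = refl

lemma7 : (ka kb : ℕ) (ca cb : Bool) (A B C : Tree) →
    ca ≡ true → cb ≡ true →
    let b  = node kb cb B C
        a  = node ka ca A b
        w  = pair a
        l  = leftChild (pair a)
    in 4 * s w * s l * s C ^ 2 ≤ s a ^ 3 * s b
lemma7 ka kb .true .true A B C refl refl =
  subst (λ x → 4 * x * s l * s C ^ 2 ≤ s a ^ 3 * s b) (sym (s-pair a))
    (4*S*p*z²≤S³*q l+C≤a (m≤n+m (s C) (1 + s B)))
  where
  b = node kb true B C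
  a = node ka true A b
  l = leftChild (pair a)
  l+C≤a : s l + s C ≤ s a
  l+C≤a = subst (s l + s C ≤_) (trans (sym (s-pair-white ka kb A B C)) (s-pair a)) (n≤1+n _)
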